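{- Let $m$ and $n$ be nonnegative integers such that $m-n$ and $m+n$ are relatively prime. Then the crisscross graph $R(m,n)$ is connected.
   Context: Since $m-n$ and $m+n$ are coprime they are odd; write $m+n=2t+1$. The crisscross graph $R(m,n)$ has vertex set all triples $(x,y,f)$ of integers with $-t\le x\le t$, $-t\le y\le t$, $f\in\{1,2\}$. Two vertices $(x_1,y_1,f_1)$ and $(x_2,y_2,f_2)$ are adjacent if and only if one of the following holds: $f_1=f_2=1$ and $(x_2,y_2)-(x_1,y_1)\in\{\pm(m,n),\pm(-n,m)\}$; $f_1=f_2=2$ and $(x_2,y_2)-(x_1,y_1)\in\{\pm(n,m),\pm(-m,n)\}$; $f_1\neq f_2$ and $(x_2,y_2)-(x_1,y_1)\in\{\pm(m,m),\pm(-m,m),\pm(n,n),\pm(-n,n)\}$. -}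

module Defs where

open import Data.Nat as ℕ using (ℕ)
open import Data.Nat.Coprimality using (Coprime)
open import Data.Integer as ℤ using (ℤ; +_; -_; _≤_)
open import Data.Product using (_×_; _,_)
open import Data.Sum using (_⊎_)
open import Relation.Binary.PropositionalEquality using (_≡_)
open import Relation.Binary.Construct.Closure.ReflexiveTransitive using (Star)

CoprimeDiffSum : ℕ → ℕ → Set
CoprimeDiffSum m n = Coprime ℤ.∣ + m ℤ.- + n ∣ (m ℕ.+ n)

-- t with m + n = 2t + 1 (m + n is odd under the hypothesis), i.e. t = ⌊(m+n)/2⌋.
half : ℕ → ℕ → ℕ
half m n = (m ℕ.+ n) ℕ./ 2

data Layer : Set where
  f1 f2 : Layer

record Vertex (m n : ℕ) : Set where
  constructor vtx
  field
    x : ℤ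
    y : ℤ
    f : Layer
    x-lo : - (+ half m n) ≤ x
    x-hi : x ≤ + half m n
    y-lo : - (+ half m n) ≤ y
    y-hi : y ≤ + half m n

open Vertex public

PlusMinus : ℤ → ℤ → ℤ → ℤ → Set
PlusMinus dx dy a b = (dx ≡ a × dy ≡ b) ⊎ (dx ≡ - a × dy ≡ - b)

Adj-diff : ℕ → ℕ → Layer → Layer → ℤ → ℤ → Set
Adj-diff m n f1 f1 dx dy = PlusMinus dx dy (+ m) (+ n) ⊎ PlusMinus dx dy (- + n) (+ m)
Adj-diff m n f2 f2 dx dy = PlusMinus dx dy (+ n) (+ m) ⊎ PlusMinus dx dy (- + m) (+ n)
Adj-diff m n f1 f2 dx dy = Cross m n dx dy
  where
  Cross : ℕ → ℕ → ℤ → ℤ → Set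
  Cross m n dx dy = (PlusMinus dx dy (+ m) (+ m) ⊎ PlusMinus dx dy (- + m) (+ m))
                  ⊎ (PlusMinus dx dy (+ n) (+ n) ⊎ PlusMinus dx dy (- + n) (+ n))
Adj-diff m n f2 f1 dx dy = Adj-diff m n f1 f2 dx dy

Adj : (m n : ℕ) → Vertex m n → Vertex m n → Set
Adj m n u v = Adj-diff m n (f u) (f v) (x v ℤ.- x u) (y v ℤ.- y u)

Connected : (m n : ℕ) → Set
Connected m n = (u v : Vertex m n) → Star (Adj m n) u v

module Submission where

-- Shift coordinates to grid positions X = x + t, 0 ≤ X < S = m + n = 2t + 1.  Modulo S
-- every edge moves each coordinate by ±n (as m ≡ -n), and "-n modulo S" is realised by
-- an actual move back by n when X ≥ n and forward by m when X < n.  Let n < m, d = m - n.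
--  * On the diagonal these moves are cross edges; S of them return to the start in
--    the other layer, S being odd, so both layers at the centre (n, n) are joined.
--  * In a central row n ≤ Y < m, two such moves of x, with y leaving the row by n and
--    returning, advance x by 2m ≡ d (mod S).  As d is coprime to S, the row is joined to
--    its point in column n; transposition (an automorphism) turns column n and every
--    central column into a central row, so all of these reach the centre.
--  * From any other position, a pair of cross edges (moves by m, then by n) brings both
--    coordinates closer to the central band, until one of them lies in it.
-- The case m < n follows from R(m,n) ≅ R(n,m), and m = n contradicts coprimality.

open import Defs
open import Data.Nat as ℕ using (ℕ; zero; suc; _≤_; _<_; s≤s; z≤n; _%_; _∸_; _⊓_)
import Data.Nat.Properties as ℕP
open import Data.Nat.DivMod using (_/_; m<n⇒m%n≡m; m%n<n; %-distribˡ-+; m%n%n≡m%n; [m+kn]%n≡m%n; [m+n]%n≡m%n; m≡m%n+[m/n]*n)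
open import Data.Nat.Divisibility using (_∣_; divides; _∣0; ∣m+n∣m⇒∣n)
open import Relation.Binary.Definitions using (tri<; tri≈; tri>)
open import Data.Nat.Coprimality using (Coprime; coprime-Bézout)
open import Data.Nat.GCD using (module Bézout)
open import Data.Nat.GeneralisedArithmetic using (fold)
import Data.Nat.Tactic.RingSolver as ℕSolver
open import Data.Integer as ℤ using (ℤ; +_; -_)
import Data.Integer.Properties as ℤP
open import Data.Integer.Tactic.RingSolver using (solve-∀)
open import Data.Sign as Sign using (Sign; opposite)
open import Data.Sign.Properties using (opposite-involutive)
open import Data.Product using (_×_; _,_; ∃; ∃₂; swap)
open import Data.Sum using (_⊎_; inj₁; inj₂)
import Data.Sum as Sum
open import Relation.Binary.PropositionalEquality
open import Relation.Nullary using (Dec; yes; no; ¬_; _×-dec_)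
open import Data.Empty using (⊥-elim)
open import Relation.Binary.Construct.Closure.ReflexiveTransitive
  using (Star; ε; _◅_; _◅◅_; gmap; reverse) renaming (map to map-walk)
open import Induction.WellFounded using (Acc; acc)
open import Data.Nat.Induction using (<-wellFounded)

infix 7 _·_
_·_ : Sign → ℤ → ℤ
Sign.+ · z = z
Sign.- · z = - z

pm-same : ∀ s a b → PlusMinus (s · a) (s · b) a b
pm-same Sign.+ a b = inj₁ (refl , refl)
pm-same Sign.- a b = inj₂ (refl , refl)

pm-opposite : ∀ s a b → PlusMinus (s · a) (opposite s · b) (- a) b
pm-opposite Sign.+ a b = inj₂ (sym (ℤP.neg-involutive a) , refl)
pm-opposite Sign.- a b = inj₁ (refl , refl)

pm-diagonal : ∀ s s' a → PlusMinus (s · a) (s' · a) a a ⊎ PlusMinus (s · a) (s' · a) (- a) a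
pm-diagonal Sign.+ Sign.+ a = inj₁ (pm-same Sign.+ a a)
pm-diagonal Sign.- Sign.- a = inj₁ (pm-same Sign.- a a)
pm-diagonal Sign.+ Sign.- a = inj₂ (pm-opposite Sign.+ a a)
pm-diagonal Sign.- Sign.+ a = inj₂ (pm-opposite Sign.- a a)

flip : Layer → Layer
flip f1 = f2
flip f2 = f1

flip-involutive : ∀ l → flip (flip l) ≡ l
flip-involutive f1 = refl
flip-involutive f2 = refl

flip-even : ∀ k l → fold l flip (k ℕ.+ k) ≡ l
flip-even zero l = refl
flip-even (suc k) l rewrite ℕP.+-suc k k = trans (flip-involutive _) (flip-even k l)

-- The direction in which layer l allows y to move by n while x moves forward by m.
layer-sign : Layer → Sign
layer-sign f1 = Sign.+
layer-sign f2 = Sign.-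

module _ {m n : ℕ} where

  cross-diff : ∀ l s s' {a} → a ≡ m ⊎ a ≡ n → Adj-diff m n l (flip l) (s · + a) (s' · + a)
  cross-diff f1 s s' (inj₁ refl) = inj₁ (pm-diagonal s s' (+ m))
  cross-diff f2 s s' (inj₁ refl) = inj₁ (pm-diagonal s s' (+ m))
  cross-diff f1 s s' (inj₂ refl) = inj₂ (pm-diagonal s s' (+ n))
  cross-diff f2 s s' (inj₂ refl) = inj₂ (pm-diagonal s s' (+ n))

  layer-diff : ∀ l → Adj-diff m n l l (+ m) (layer-sign l · + n)
  layer-diff f1 = inj₁ (pm-same Sign.+ (+ m) (+ n))
  layer-diff f2 = inj₂ (pm-opposite Sign.+ (+ m) (+ n))

pm-negate : ∀ {dx dy a b} → PlusMinus dx dy a b → PlusMinus (- dx) (- dy) a b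
pm-negate (inj₁ (refl , refl)) = inj₂ (refl , refl)
pm-negate {a = a} {b} (inj₂ (refl , refl)) = inj₁ (ℤP.neg-involutive a , ℤP.neg-involutive b)

pm-swap : ∀ {dx dy a b} → PlusMinus dx dy a b → PlusMinus dy dx b a
pm-swap = Sum.map swap swap

-- Swapping (-a, b) gives (b, -a) = -(-b, a).
pm-antiswap : ∀ {dx dy a b} → PlusMinus dx dy (- a) b → PlusMinus dy dx (- b) a
pm-antiswap {b = b} (inj₁ (refl , refl)) = inj₂ (sym (ℤP.neg-involutive b) , refl)
pm-antiswap {a = a} (inj₂ (refl , refl)) = inj₁ (refl , ℤP.neg-involutive a)

module _ {m n : ℕ} where

  negate-diff : ∀ l l' {dx dy} → Adj-diff m n l l' dx dy → Adj-diff m n l' l (- dx) (- dy)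
  negate-diff f1 f1 = Sum.map pm-negate pm-negate
  negate-diff f2 f2 = Sum.map pm-negate pm-negate
  negate-diff f1 f2 = Sum.map (Sum.map pm-negate pm-negate) (Sum.map pm-negate pm-negate)
  negate-diff f2 f1 = Sum.map (Sum.map pm-negate pm-negate) (Sum.map pm-negate pm-negate)

  adj-sym : ∀ {u v : Vertex m n} → Adj m n u v → Adj m n v u
  adj-sym {u} {v} a = subst₂ (Adj-diff m n (f v) (f u)) (negate-sub (x v) (x u)) (negate-sub (y v) (y u))
                        (negate-diff (f u) (f v) a)
    where
    negate-sub : ∀ a b → - (a ℤ.- b) ≡ b ℤ.- a
    negate-sub = solve-∀

  transpose-diff : ∀ l l' {dx dy} → Adj-diff m n l l' dx dy → Adj-diff m n (flip l) (flip l') dy dx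
  transpose-diff f1 f1 = Sum.map pm-swap pm-antiswap
  transpose-diff f2 f2 = Sum.map pm-swap pm-antiswap
  transpose-diff f1 f2 = Sum.map (Sum.map pm-swap pm-antiswap) (Sum.map pm-swap pm-antiswap)
  transpose-diff f2 f1 = Sum.map (Sum.map pm-swap pm-antiswap) (Sum.map pm-swap pm-antiswap)

  transpose : Vertex m n → Vertex m n
  transpose (vtx x y l x-lo x-hi y-lo y-hi) = vtx y x (flip l) y-lo y-hi x-lo x-hi

  transpose-adj : ∀ {u v} → Adj m n u v → Adj m n (transpose u) (transpose v)
  transpose-adj {vtx _ _ l _ _ _ _} {vtx _ _ l' _ _ _ _} = transpose-diff l l'

vertex-ext : ∀ {m n} {u v : Vertex m n} → x u ≡ x v → y u ≡ y v → f u ≡ f v → u ≡ v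
vertex-ext {u = vtx _ _ _ a b c d} {vtx _ _ _ a' b' c' d'} refl refl refl
  rewrite ℤP.≤-irrelevant a a' | ℤP.≤-irrelevant b b' | ℤP.≤-irrelevant c c' | ℤP.≤-irrelevant d d' = refl

swap-vertex : ∀ {m n} → Vertex m n → Vertex n m
swap-vertex {m} {n} (vtx x y l a b c d) =
  vtx x y (flip l) (subst (λ h → - (+ h) ℤ.≤ x) half-comm a) (subst (λ h → x ℤ.≤ + h) half-comm b)
                   (subst (λ h → - (+ h) ℤ.≤ y) half-comm c) (subst (λ h → y ℤ.≤ + h) half-comm d)
  where
  half-comm : half m n ≡ half n m
  half-comm = cong (ℕ._/ 2) (ℕP.+-comm m n)

swap-diff : ∀ {m n} l l' {dx dy} → Adj-diff m n l l' dx dy → Adj-diff n m (flip l) (flip l') dx dy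
swap-diff f1 f1 a = a
swap-diff f2 f2 a = a
swap-diff f1 f2 a = Sum.swap a
swap-diff f2 f1 a = Sum.swap a

swap-adj : ∀ {m n} {u v : Vertex m n} → Adj m n u v → Adj n m (swap-vertex u) (swap-vertex v)
swap-adj {u = vtx _ _ l _ _ _ _} {vtx _ _ l' _ _ _ _} = swap-diff l l'

swap-swap : ∀ {m n} (u : Vertex m n) → swap-vertex (swap-vertex u) ≡ u
swap-swap u = vertex-ext refl refl (flip-involutive (f u))

connected-swap : ∀ {m n} → Connected n m → Connected m n
connected-swap {m} {n} conn u v = subst₂ (Star (Adj m n)) (swap-swap u) (swap-swap v)
  (gmap swap-vertex (λ {u'} {v'} → swap-adj {n} {m} {u'} {v'}) (conn (swap-vertex u) (swap-vertex v)))

module Modular (s : ℕ) where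

  S : ℕ
  S = suc s

  mod-add : ∀ a b → (b ℕ.+ a % S) % S ≡ (b ℕ.+ a) % S
  mod-add a b = begin
    (b ℕ.+ a % S) % S            ≡⟨ %-distribˡ-+ b (a % S) S ⟩
    (b % S ℕ.+ a % S % S) % S    ≡⟨ cong (λ z → (b % S ℕ.+ z) % S) (m%n%n≡m%n a S) ⟩
    (b % S ℕ.+ a % S) % S        ≡⟨ %-distribˡ-+ b a S ⟨
    (b ℕ.+ a) % S                ∎
    where open ≡-Reasoning

  orbit : ∀ c (P : ℕ → ℕ → Set) → (∀ {k X} → X < S → P k X → P (suc k) ((c ℕ.+ X) % S)) →
          ∀ {X₀} → X₀ < S → P 0 X₀ → ∀ k → P k ((k ℕ.* c ℕ.+ X₀) % S)
  orbit c P step {X₀} X₀<S start zero = subst (P 0) (sym (m<n⇒m%n≡m X₀<S)) start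
  orbit c P step {X₀} X₀<S start (suc k) =
    subst (P (suc k)) next (step (m%n<n (k ℕ.* c ℕ.+ X₀) S) (orbit c P step X₀<S start k))
    where
    next : (c ℕ.+ (k ℕ.* c ℕ.+ X₀) % S) % S ≡ (suc k ℕ.* c ℕ.+ X₀) % S
    next = trans (mod-add (k ℕ.* c ℕ.+ X₀) c) (cong (_% S) (sym (ℕP.+-assoc c (k ℕ.* c) X₀)))

  orbit-hits : ∀ {c} → Coprime c S → ∀ X {X'} → X' < S → ∃ λ k → (k ℕ.* c ℕ.+ X) % S ≡ X'
  orbit-hits {c} cop X {X'} X'<S with coprime-Bézout cop
  ... | Bézout.+- x y eq = x ℕ.* A , (begin
        (x ℕ.* A ℕ.* c ℕ.+ X) % S             ≡⟨ cong (λ z → (z ℕ.+ X) % S) (regroup x A c) ⟩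
        (A ℕ.* (x ℕ.* c) ℕ.+ X) % S           ≡⟨ cong (λ z → (A ℕ.* z ℕ.+ X) % S) eq ⟨
        (A ℕ.* (1 ℕ.+ y ℕ.* S) ℕ.+ X) % S     ≡⟨ cong (_% S) (expand X X' s y) ⟩
        (X' ℕ.+ (X ℕ.+ A ℕ.* y) ℕ.* S) % S    ≡⟨ [m+kn]%n≡m%n X' (X ℕ.+ A ℕ.* y) S ⟩
        X' % S                                ≡⟨ m<n⇒m%n≡m X'<S ⟩
        X'                                    ∎)
    where
    open ≡-Reasoning
    -- A ≡ X' - X (mod S), and x c ≡ 1
    A : ℕ
    A = X' ℕ.+ X ℕ.* s
    regroup : ∀ a b c → a ℕ.* b ℕ.* c ≡ b ℕ.* (a ℕ.* c)
    regroup = ℕSolver.solve-∀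
    expand : ∀ X X' s y → (X' ℕ.+ X ℕ.* s) ℕ.* (1 ℕ.+ y ℕ.* suc s) ℕ.+ X
                          ≡ X' ℕ.+ (X ℕ.+ (X' ℕ.+ X ℕ.* s) ℕ.* y) ℕ.* suc s
    expand = ℕSolver.solve-∀
  ... | Bézout.-+ x y eq = x ℕ.* B , (begin
        (x ℕ.* B ℕ.* c ℕ.+ X) % S                 ≡⟨ [m+kn]%n≡m%n (x ℕ.* B ℕ.* c ℕ.+ X) X' S ⟨
        (x ℕ.* B ℕ.* c ℕ.+ X ℕ.+ X' ℕ.* S) % S    ≡⟨ cong (_% S) (expand X X' s x c) ⟩
        (X' ℕ.+ B ℕ.* (1 ℕ.+ x ℕ.* c)) % S        ≡⟨ cong (λ z → (X' ℕ.+ B ℕ.* z) % S) eq ⟩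
        (X' ℕ.+ B ℕ.* (y ℕ.* S)) % S              ≡⟨ cong (λ z → (X' ℕ.+ z) % S) (ℕP.*-assoc B y S) ⟨
        (X' ℕ.+ B ℕ.* y ℕ.* S) % S                ≡⟨ [m+kn]%n≡m%n X' (B ℕ.* y) S ⟩
        X' % S                                    ≡⟨ m<n⇒m%n≡m X'<S ⟩
        X'                                        ∎)
    where
    open ≡-Reasoning
    -- B ≡ X - X' (mod S), and x c ≡ -1
    B : ℕ
    B = X ℕ.+ X' ℕ.* s
    expand : ∀ X X' s x c → x ℕ.* (X ℕ.+ X' ℕ.* s) ℕ.* c ℕ.+ X ℕ.+ X' ℕ.* suc s
                            ≡ X' ℕ.+ (X ℕ.+ X' ℕ.* s) ℕ.* (1 ℕ.+ x ℕ.* c)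
    expand = ℕSolver.solve-∀

-- A vertex coordinate -t ≤ x ≤ t is encoded by the natural
-- number X = x + t < S = 2t + 1, so that adjacency becomes a statement about
-- moves of natural numbers.  The encoding clamps out-of-range positions, which
-- makes the vertex at a position a total function of the position.
module Grid (m n : ℕ) where

  t : ℕ
  t = half m n

  open Modular (t ℕ.+ t) public

  coord : ℕ → ℤ
  coord X = + (X ⊓ (t ℕ.+ t)) ℤ.- + t

  coord-lo : ∀ X → - (+ t) ℤ.≤ coord X
  coord-lo X = subst (ℤ._≤ coord X) (ℤP.+-identityˡ (- + t)) (ℤP.+-monoˡ-≤ (- + t) (ℤ.+≤+ z≤n))

  coord-hi : ∀ X → coord X ℤ.≤ + t
  coord-hi X = subst (coord X ℤ.≤_) top (ℤP.+-monoˡ-≤ (- + t) (ℤ.+≤+ (ℕP.m⊓n≤n X (t ℕ.+ t))))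
    where
    cancel : ∀ a → (a ℤ.+ a) ℤ.- a ≡ a
    cancel = solve-∀
    top : + (t ℕ.+ t) ℤ.- + t ≡ + t
    top = trans (cong (ℤ._- + t) (ℤP.pos-+ t t)) (cancel (+ t))

  coord-exact : ∀ {X} → X < S → coord X ≡ + X ℤ.- + t
  coord-exact X<S = cong (λ z → + z ℤ.- + t) (ℕP.m≤n⇒m⊓n≡m (ℕP.≤-pred X<S))

  coord-onto : ∀ z → - (+ t) ℤ.≤ z → z ℤ.≤ + t → ∃ λ X → X < S × coord X ≡ z
  coord-onto z lo hi = ℤ.∣ w ∣ , s≤s bound , trans (coord-exact (s≤s bound)) back
    where
    w : ℤ
    w = z ℤ.+ + t
    w-nonneg : + 0 ℤ.≤ w
    w-nonneg = subst (ℤ._≤ w) (ℤP.+-inverseˡ (+ t)) (ℤP.+-monoˡ-≤ (+ t) lo)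
    ∣w∣ : + ℤ.∣ w ∣ ≡ w
    ∣w∣ = ℤP.0≤i⇒+∣i∣≡i w-nonneg
    bound : ℤ.∣ w ∣ ≤ t ℕ.+ t
    bound = ℤP.drop‿+≤+ (subst₂ ℤ._≤_ (sym ∣w∣) (sym (ℤP.pos-+ t t)) (ℤP.+-monoˡ-≤ (+ t) hi))
    cancel : ∀ a b → (a ℤ.+ b) ℤ.- b ≡ a
    cancel = solve-∀
    back : + ℤ.∣ w ∣ ℤ.- + t ≡ z
    back = trans (cong (ℤ._- + t) ∣w∣) (cancel z (+ t))

  data Move (k : ℕ) : Sign → ℕ → ℕ → Set where
    forward  : ∀ {X X'} → X' ≡ k ℕ.+ X → X' < S → Move k Sign.+ X X'
    backward : ∀ {X X'} → X ≡ k ℕ.+ X' → X < S → Move k Sign.- X X'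

  source : ∀ {k s X X'} → Move k s X X' → X < S
  source (forward refl X'<S) = ℕP.≤-<-trans (ℕP.m≤n+m _ _) X'<S
  source (backward _ X<S) = X<S

  target : ∀ {k s X X'} → Move k s X X' → X' < S
  target (forward _ X'<S) = X'<S
  target (backward refl X<S) = ℕP.≤-<-trans (ℕP.m≤n+m _ _) X<S

  reverse-move : ∀ {k s X X'} → Move k s X X' → Move k (opposite s) X' X
  reverse-move (forward e X'<S) = backward e X'<S
  reverse-move (backward e X<S) = forward e X<S

  move-diff : ∀ {k s X X'} → Move k s X X' → coord X' ℤ.- coord X ≡ s · + k
  move-diff {k} {X = X} mv@(forward refl _) = begin
    coord (k ℕ.+ X) ℤ.- coord X                  ≡⟨ cong₂ ℤ._-_ (coord-exact (target mv)) (coord-exact (source mv)) ⟩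
    (+ (k ℕ.+ X) ℤ.- + t) ℤ.- (+ X ℤ.- + t)      ≡⟨ cong (λ z → (z ℤ.- + t) ℤ.- (+ X ℤ.- + t)) (ℤP.pos-+ k X) ⟩
    ((+ k ℤ.+ + X) ℤ.- + t) ℤ.- (+ X ℤ.- + t)    ≡⟨ cancel (+ k) (+ X) (+ t) ⟩
    + k                                          ∎
    where
    open ≡-Reasoning
    cancel : ∀ a b c → ((a ℤ.+ b) ℤ.- c) ℤ.- (b ℤ.- c) ≡ a
    cancel = solve-∀
  move-diff {k} {X' = X'} mv@(backward refl _) = begin
    coord X' ℤ.- coord (k ℕ.+ X')                ≡⟨ cong₂ ℤ._-_ (coord-exact (target mv)) (coord-exact (source mv)) ⟩
    (+ X' ℤ.- + t) ℤ.- (+ (k ℕ.+ X') ℤ.- + t)    ≡⟨ cong (λ z → (+ X' ℤ.- + t) ℤ.- (z ℤ.- + t)) (ℤP.pos-+ k X') ⟩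
    (+ X' ℤ.- + t) ℤ.- ((+ k ℤ.+ + X') ℤ.- + t)  ≡⟨ cancel (+ k) (+ X') (+ t) ⟩
    - + k                                        ∎
    where
    open ≡-Reasoning
    cancel : ∀ a b c → (b ℤ.- c) ℤ.- ((a ℤ.+ b) ℤ.- c) ≡ - a
    cancel = solve-∀

  -- Edges, wrapped in a record so that walks can infer their intermediate vertices.
  record _⟶_ (u v : Vertex m n) : Set where
    constructor edge-of
    field adjacent : Adj m n u v

  _⇝_ : Vertex m n → Vertex m n → Set
  _⇝_ = Star _⟶_

  -- The vertex at a grid position.  It is kept opaque: only the lemmas below look
  -- inside it, and elsewhere grid vertices are compared through their positions.
  opaque
    V : ℕ → ℕ → Layer → Vertex m n
    V X Y l = vtx (coord X) (coord Y) l (coord-lo X) (coord-hi X) (coord-lo Y) (coord-hi Y)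

  opaque
    unfolding V

    V-onto : (u : Vertex m n) → ∃₂ λ X Y → ∃ λ l → X < S × Y < S × V X Y l ≡ u
    V-onto u with coord-onto (x u) (x-lo u) (x-hi u) | coord-onto (y u) (y-lo u) (y-hi u)
    ... | X , X<S , refl | Y , Y<S , refl = X , Y , f u , X<S , Y<S , vertex-ext refl refl refl

    edge : ∀ {l l' s s' a b X X' Y Y'} → Adj-diff m n l l' (s · + a) (s' · + b) →
           Move a s X X' → Move b s' Y Y' → V X Y l ⟶ V X' Y' l'
    edge {l} {l'} δ mx my = edge-of (subst₂ (Adj-diff m n l l') (sym (move-diff mx)) (sym (move-diff my)) δ)

    -- Walks transposed: the transpose of the grid vertex (Y, X, flip l) is (X, Y, l).
    transposed : ∀ {X Y X' Y' l l'} → V Y X (flip l) ⇝ V Y' X' l' → V X Y l ⇝ V X' Y' (flip l')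
    transposed {X} {Y} {X'} {Y'} {l} {l'} w =
      subst (λ l₀ → V X Y l₀ ⇝ V X' Y' (flip l')) (flip-involutive l)
        (gmap transpose (λ {u} {v} (edge-of a) → edge-of (transpose-adj {m} {n} {u} {v} a)) w)

  cross-edge : ∀ l {s s' a X X' Y Y'} → Move a s X X' → Move a s' Y Y' → a ≡ m ⊎ a ≡ n →
               V X Y l ⟶ V X' Y' (flip l)
  cross-edge l {s} {s'} mx my a≡ = edge {l} {flip l} (cross-diff l s s' a≡) mx my

  layer-edge : ∀ l {X X' Y Y'} → Move m Sign.+ X X' → Move n (layer-sign l) Y Y' → V X Y l ⟶ V X' Y' l
  layer-edge l = edge {l} {l} (layer-diff {m} {n} l)

module Connectivity (n e : ℕ) where

  d m : ℕ
  d = suc e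
  m = n ℕ.+ d

  open Grid m n

  Central : ℕ → Set
  Central X = n ≤ X × X < m

  central? : ∀ X → Dec (Central X)
  central? X = (n ℕ.≤? X) ×-dec (X ℕ.<? m)

  n-central : Central n
  n-central = ℕP.≤-refl , ℕP.m<m+n n (s≤s z≤n)

  base : Vertex m n
  base = V n n f1

  module Walks (odd : m ℕ.+ n ≡ S) (cop : Coprime d S) where

    n+m≡S : n ℕ.+ m ≡ S
    n+m≡S = trans (ℕP.+-comm n m) odd

    central<S : ∀ {X} → Central X → X < S
    central<S (_ , X<m) = ℕP.<-≤-trans X<m (subst (m ≤_) odd (ℕP.m≤m+n m n))

    S+-mod : ∀ a → (S ℕ.+ a) % S ≡ a % S
    S+-mod a = trans (cong (_% S) (ℕP.+-comm S a)) ([m+n]%n≡m%n a S)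

    small-forward : ∀ {X} → X < n → m ℕ.+ X < S
    small-forward {X} X<n = subst (m ℕ.+ X <_) odd (ℕP.+-monoʳ-< m X<n)

    -- Moving by -n modulo S: back by n when possible, otherwise forward by m.
    data BackStep (X X' : ℕ) : Set where
      by-n : Move n Sign.- X X' → BackStep X X'
      by-m : X < n → Move m Sign.+ X X' → BackStep X X'

    back-step : ∀ {X} → X < S → ∃ λ X' → BackStep X X' × X' ≡ (m ℕ.+ X) % S
    back-step {X} X<S with X ℕ.<? n
    ... | yes X<n =
      m ℕ.+ X , by-m X<n (forward refl (small-forward X<n)) , sym (m<n⇒m%n≡m (small-forward X<n))
    ... | no X≮n with ℕP.m≤n⇒∃[o]m+o≡n (ℕP.≮⇒≥ X≮n)
    ...   | X₀ , refl = X₀ , by-n (backward refl X<S) , sym (begin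
      (m ℕ.+ (n ℕ.+ X₀)) % S  ≡⟨ cong (_% S) (trans (sym (ℕP.+-assoc m n X₀)) (cong (ℕ._+ X₀) odd)) ⟩
      (S ℕ.+ X₀) % S          ≡⟨ S+-mod X₀ ⟩
      X₀ % S                  ≡⟨ m<n⇒m%n≡m (ℕP.≤-<-trans (ℕP.m≤n+m X₀ n) X<S) ⟩
      X₀                      ∎)
      where open ≡-Reasoning

    diagonal-edge : ∀ {X} l → X < S → V X X l ⟶ V ((m ℕ.+ X) % S) ((m ℕ.+ X) % S) (flip l)
    diagonal-edge l X<S with back-step X<S
    ... | _ , by-n mv , refl = cross-edge l mv mv (inj₂ refl)
    ... | _ , by-m _ mv , refl = cross-edge l mv mv (inj₁ refl)

    -- Walking S times along the diagonal returns to the start in the other layer (S is odd).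
    diagonal-flip : ∀ {X} l → X < S → V X X l ⇝ V X X (flip l)
    diagonal-flip {X} l X<S =
      subst₂ (λ Z l' → V X X l ⇝ V Z Z l') back-home (cong flip (flip-even t l))
        (orbit m (λ k Z → V X X l ⇝ V Z Z (fold l flip k))
               (λ {k} Z<S w → w ◅◅ diagonal-edge (fold l flip k) Z<S ◅ ε) X<S ε S)
      where
      back-home : (S ℕ.* m ℕ.+ X) % S ≡ X
      back-home = trans (cong (λ z → (z ℕ.+ X) % S) (ℕP.*-comm S m))
                        (trans (cong (_% S) (ℕP.+-comm (m ℕ.* S) X))
                               (trans ([m+kn]%n≡m%n X m S) (m<n⇒m%n≡m X<S)))

    centre-to-base : ∀ l → V n n l ⇝ base
    centre-to-base f1 = ε
    centre-to-base f2 = diagonal-flip f2 (central<S n-central)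

    central-move : ∀ {Y} → Central Y → ∀ s → ∃ λ Y' → Move n s Y Y'
    central-move {Y} (_ , Y<m) Sign.+ =
      n ℕ.+ Y , forward refl (subst (n ℕ.+ Y <_) n+m≡S (ℕP.+-monoʳ-< n Y<m))
    central-move cY@(n≤Y , _) Sign.- with ℕP.m≤n⇒∃[o]m+o≡n n≤Y
    ... | Y₀ , refl = Y₀ , backward refl (central<S cY)

    -- Two back steps of x in a central row: y leaves the row by n and returns,
    -- the directions chosen so that any step of x by m is a layer edge.
    two-back-steps : ∀ {X X₁ X₂ Y} l → Central Y → BackStep X X₁ → BackStep X₁ X₂ →
                     ∃ λ l' → V X Y l ⇝ V X₂ Y l'
    two-back-steps l cY (by-n a) (by-n b) with central-move cY Sign.+
    ... | _ , u = flip (flip l) , cross-edge l a u (inj₂ refl)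
                                 ◅ cross-edge (flip l) b (reverse-move u) (inj₂ refl) ◅ ε
    two-back-steps l cY (by-m _ a) (by-n b) with central-move cY (layer-sign l)
    ... | _ , u = flip l , layer-edge l a u ◅ cross-edge l b (reverse-move u) (inj₂ refl) ◅ ε
    two-back-steps l cY (by-n a) (by-m _ b) with central-move cY (opposite (layer-sign (flip l)))
    ... | _ , u = flip l , cross-edge l a u (inj₂ refl)
                    ◅ layer-edge (flip l) b (subst (λ s → Move n s _ _) (opposite-involutive _) (reverse-move u))
                    ◅ ε
    two-back-steps l cY (by-m _ (forward refl _)) (by-m m+X<n _) =
      ⊥-elim (ℕP.<⇒≱ m+X<n (ℕP.≤-trans (ℕP.m≤m+n n d) (ℕP.m≤m+n m _)))

    -- In a central row, x advances by d modulo S: two back steps, as 2m ≡ d (mod S).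
    row-step : ∀ {X Y} l → Central Y → X < S → ∃ λ l' → V X Y l ⇝ V ((d ℕ.+ X) % S) Y l'
    row-step {X} {Y} l cY X<S with back-step X<S
    ... | _ , st₁ , refl with back-step (m%n<n (m ℕ.+ X) S)
    ...   | _ , st₂ , refl =
      subst (λ Z → ∃ λ l' → V X Y l ⇝ V Z Y l') twice (two-back-steps l cY st₁ st₂)
      where
      regroup : ∀ n e X → (n ℕ.+ suc e) ℕ.+ ((n ℕ.+ suc e) ℕ.+ X)
                          ≡ ((n ℕ.+ suc e) ℕ.+ n) ℕ.+ (suc e ℕ.+ X)
      regroup = ℕSolver.solve-∀
      twice : (m ℕ.+ (m ℕ.+ X) % S) % S ≡ (d ℕ.+ X) % S
      twice = begin
        (m ℕ.+ (m ℕ.+ X) % S) % S      ≡⟨ mod-add (m ℕ.+ X) m ⟩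
        (m ℕ.+ (m ℕ.+ X)) % S          ≡⟨ cong (_% S) (regroup n e X) ⟩
        (m ℕ.+ n ℕ.+ (d ℕ.+ X)) % S    ≡⟨ cong (λ z → (z ℕ.+ (d ℕ.+ X)) % S) odd ⟩
        (S ℕ.+ (d ℕ.+ X)) % S          ≡⟨ S+-mod (d ℕ.+ X) ⟩
        (d ℕ.+ X) % S                  ∎
        where open ≡-Reasoning

    -- As d is coprime to S, iterated row steps join every point of a central row
    -- to its point in column n.
    row-to-centre : ∀ {X Y} l → Central Y → X < S → ∃ λ l' → V X Y l ⇝ V n Y l'
    row-to-centre {X} {Y} l cY X<S with orbit-hits cop X (central<S n-central)
    ... | k , hit = subst (λ Z → ∃ λ l' → V X Y l ⇝ V Z Y l') hit
                      (orbit d (λ _ Z → ∃ λ l' → V X Y l ⇝ V Z Y l') (λ {_} → extend) X<S (l , ε) k)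
      where
      extend : ∀ {Z} → Z < S → (∃ λ l' → V X Y l ⇝ V Z Y l') →
               ∃ λ l' → V X Y l ⇝ V ((d ℕ.+ Z) % S) Y l'
      extend Z<S (l' , w) with row-step l' cY Z<S
      ... | l'' , w' = l'' , w ◅◅ w'

    -- Every vertex in a central row is joined to base: go along the row to column n,
    -- then along column n (a central row after transposition) to the centre.
    central-row-to-base : ∀ {X Y} l → Central Y → X < S → V X Y l ⇝ base
    central-row-to-base l cY X<S with row-to-centre l cY X<S
    ... | l₁ , along-row with row-to-centre (flip l₁) n-central (central<S cY)
    ...   | l₂ , along-column = along-row ◅◅ transposed along-column ◅◅ centre-to-base (flip l₂)

    central-column-to-base : ∀ {X Y} l → Central X → Y < S → V X Y l ⇝ base
    central-column-to-base l cX Y<S =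
      transposed (central-row-to-base (flip l) cX Y<S) ◅◅ centre-to-base f2

    -- Distance of a grid position from the central band.
    offset : ℕ → ℕ
    offset X = (n ∸ X) ℕ.+ (X ∸ (n ℕ.+ e))

    offset-small : ∀ {X} → X < n → offset (d ℕ.+ X) < offset X
    offset-small {X} X<n = begin-strict
      offset (d ℕ.+ X)          ≡⟨ cong (n ∸ (d ℕ.+ X) ℕ.+_) (ℕP.m≤n⇒m∸n≡0 d+X≤n+e) ⟩
      n ∸ (d ℕ.+ X) ℕ.+ 0       ≡⟨ ℕP.+-identityʳ _ ⟩
      n ∸ (d ℕ.+ X)             ≤⟨ ℕP.∸-monoʳ-≤ n (s≤s (ℕP.m≤n+m X e)) ⟩
      n ∸ suc X                 <⟨ ℕP.∸-monoʳ-< ℕP.≤-refl X<n ⟩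
      n ∸ X                     ≤⟨ ℕP.m≤m+n _ _ ⟩
      offset X                  ∎
      where
      open ℕP.≤-Reasoning
      d+X≤n+e : d ℕ.+ X ≤ n ℕ.+ e
      d+X≤n+e = subst (d ℕ.+ X ≤_) (ℕP.+-comm e n) (ℕP.+-monoʳ-< e X<n)

    offset-large : ∀ X₀ → offset (n ℕ.+ X₀) < offset (m ℕ.+ X₀)
    offset-large X₀ = begin-strict
      offset (n ℕ.+ X₀)                ≡⟨ cong (ℕ._+ (n ℕ.+ X₀ ∸ (n ℕ.+ e)))
                                                  (ℕP.m≤n⇒m∸n≡0 (ℕP.m≤m+n n X₀)) ⟩
      n ℕ.+ X₀ ∸ (n ℕ.+ e)             ≤⟨ ℕP.∸-monoʳ-≤ (n ℕ.+ X₀) (ℕP.m≤m+n n e) ⟩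
      n ℕ.+ X₀ ∸ n                     ≡⟨ ℕP.m+n∸m≡n n X₀ ⟩
      X₀                               <⟨ ℕP.n<1+n X₀ ⟩
      suc X₀                           ≡⟨ ℕP.m+n∸m≡n (n ℕ.+ e) (suc X₀) ⟨
      n ℕ.+ e ℕ.+ suc X₀ ∸ (n ℕ.+ e)   ≡⟨ cong (_∸ (n ℕ.+ e)) (regroup n e X₀) ⟩
      m ℕ.+ X₀ ∸ (n ℕ.+ e)             ≤⟨ ℕP.m≤n+m _ _ ⟩
      offset (m ℕ.+ X₀)                ∎
      where
      open ℕP.≤-Reasoning
      regroup : ∀ n e X → n ℕ.+ e ℕ.+ suc X ≡ n ℕ.+ suc e ℕ.+ X
      regroup = ℕSolver.solve-∀

    -- A position outside the central band returns towards it by a move of length m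
    -- followed by a move of length n: small positions gain d, large ones lose d.
    Inward : ℕ → Set
    Inward X = ∃₂ λ X₁ X₂ → (∃ λ s → Move m s X X₁) × (∃ λ s → Move n s X₁ X₂) × offset X₂ < offset X

    inward : ∀ {X} → X < S → ¬ Central X → Inward X
    inward {X} X<S off with X ℕ.<? n
    ... | yes X<n = m ℕ.+ X , d ℕ.+ X , (_ , forward refl (small-forward X<n))
                  , (_ , backward (ℕP.+-assoc n d X) (small-forward X<n)) , offset-small X<n
    ... | no X≮n with ℕP.m≤n⇒∃[o]m+o≡n (ℕP.≮⇒≥ (λ X<m → off (ℕP.≮⇒≥ X≮n , X<m)))
    ...   | X₀ , refl = X₀ , n ℕ.+ X₀ , (_ , backward refl X<S)
                      , (_ , forward refl (ℕP.≤-<-trans (ℕP.+-monoˡ-≤ X₀ (ℕP.m≤m+n n d)) X<S))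
                      , offset-large X₀

    -- Every grid vertex is joined to base: both coordinates move inwards, by a pair of
    -- cross edges, until one of them is central.
    grid-to-base : ∀ {X Y} l → X < S → Y < S → Acc _<_ (offset X) → V X Y l ⇝ base
    grid-to-base {X} {Y} l X<S Y<S (acc closer) = by-cases (central? X) (central? Y)
      where
      inwards : Inward X → Inward Y → V X Y l ⇝ base
      inwards (_ , _ , (_ , out) , (_ , back) , nearer) (_ , _ , (_ , out') , (_ , back') , _) =
        cross-edge l out out' (inj₁ refl) ◅ cross-edge (flip l) back back' (inj₂ refl)
          ◅ grid-to-base (flip (flip l)) (target back) (target back') (closer nearer)
      by-cases : Dec (Central X) → Dec (Central Y) → V X Y l ⇝ base
      by-cases (yes cX) _ = central-column-to-base l cX Y<S
      by-cases (no _) (yes cY) = central-row-to-base l cY X<S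
      by-cases (no offX) (no offY) = inwards (inward X<S offX) (inward Y<S offY)

    to-base : (u : Vertex m n) → Star (Adj m n) u base
    to-base u with V-onto u
    ... | X , Y , l , X<S , Y<S , refl =
      map-walk _⟶_.adjacent (grid-to-base l X<S Y<S (<-wellFounded _))

    connected : Connected m n
    connected u v = to-base u ◅◅ reverse (λ {u} {v} → adj-sym {m} {n} {u} {v}) (to-base v)

two∣double : ∀ b → 2 ∣ b ℕ.+ b
two∣double b = divides b (double b)
  where
  double : ∀ b → b ℕ.+ b ≡ b ℕ.* 2
  double = ℕSolver.solve-∀

2≢1 : 2 ≢ 1
2≢1 ()

coprime⇒odd : ∀ {a b M} → a ℕ.+ (b ℕ.+ b) ≡ M → Coprime a M → M ≡ suc (M / 2 ℕ.+ M / 2)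
coprime⇒odd {a} {b} {M} a+2b≡M cop with M % 2 | m%n<n M 2 | m≡m%n+[m/n]*n M 2
... | zero | _ | M≡2h = ⊥-elim (2≢1 (cop (∣m+n∣m⇒∣n 2∣2b+a (two∣double b) , 2∣M)))
  where
  2∣M : 2 ∣ M
  2∣M = divides (M / 2) M≡2h
  2∣2b+a : 2 ∣ (b ℕ.+ b) ℕ.+ a
  2∣2b+a = subst (2 ∣_) (trans (sym a+2b≡M) (ℕP.+-comm a (b ℕ.+ b))) 2∣M
... | suc zero | _ | M≡2h+1 = trans M≡2h+1 (cong suc (double (M / 2)))
  where
  double : ∀ h → h ℕ.* 2 ≡ h ℕ.+ h
  double = ℕSolver.solve-∀
... | suc (suc _) | s≤s (s≤s ()) | _

difference : ∀ n d → ℤ.∣ + (n ℕ.+ d) ℤ.- + n ∣ ≡ d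
difference n d = cong ℤ.∣_∣ (trans (cong (ℤ._- + n) (ℤP.pos-+ n d)) (cancel (+ n) (+ d)))
  where
  cancel : ∀ a b → (a ℤ.+ b) ℤ.- a ≡ b
  cancel = solve-∀

connected-above : ∀ n e → CoprimeDiffSum (n ℕ.+ suc e) n → Connected (n ℕ.+ suc e) n
connected-above n e cop = Connectivity.Walks.connected n e odd (subst (Coprime (suc e)) odd cop')
  where
  cop' : Coprime (suc e) (n ℕ.+ suc e ℕ.+ n)
  cop' = subst (λ a → Coprime a (n ℕ.+ suc e ℕ.+ n)) (difference n (suc e)) cop
  regroup : ∀ n e → suc e ℕ.+ (n ℕ.+ n) ≡ n ℕ.+ suc e ℕ.+ n
  regroup = ℕSolver.solve-∀
  odd : n ℕ.+ suc e ℕ.+ n ≡ suc (half (n ℕ.+ suc e) n ℕ.+ half (n ℕ.+ suc e) n)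
  odd = coprime⇒odd {b = n} (regroup n e) cop'

-- m - n and m + n are never coprime when m = n: 2 divides both 0 and 2m.
equal-not-coprime : ∀ m → ¬ CoprimeDiffSum m m
equal-not-coprime m cop = 2≢1 (cop (2∣0-diff , two∣double m))
  where
  2∣0-diff : 2 ∣ ℤ.∣ + m ℤ.- + m ∣
  2∣0-diff = subst (2 ∣_) (sym (cong ℤ.∣_∣ (ℤP.+-inverseʳ (+ m)))) (2 ∣0)

swap-coprime : ∀ {m n} → CoprimeDiffSum m n → CoprimeDiffSum n m
swap-coprime {m} {n} = subst₂ Coprime (ℤP.∣i-j∣≡∣j-i∣ (+ m) (+ n)) (ℕP.+-comm m n)

connected-if-larger : ∀ {m n} → n < m → CoprimeDiffSum m n → Connected m n
connected-if-larger {n = n} n<m with ℕP.m≤n⇒∃[o]m+o≡n n<m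
... | e , refl = subst (λ m → CoprimeDiffSum m n → Connected m n) (ℕP.+-suc n e) (connected-above n e)

lemma5 : (m n : ℕ) → CoprimeDiffSum m n → Connected m n
lemma5 m n cop with ℕP.<-cmp m n
... | tri< m<n _ _ = connected-swap (connected-if-larger m<n (swap-coprime {m} {n} cop))
... | tri≈ _ refl _ = ⊥-elim (equal-not-coprime m cop)
... | tri> _ _ n<m = connected-if-larger n<m cop
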